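{- Let $r\ge2$, let $n_1,\dots,n_r$ be nonnegative integers and let $z_1,\dots,z_r\in\mathbb{C}$. Then \[ \zeta_r(-n_1,\dots,-n_r;z_1,\dots,z_{r-1},z_r+1)=\zeta_r(-n_1,\dots,-n_r;z_1,\dots,z_r)+(-1)^{n_r}\sum_{k=0}^{n_r}\binom{n_r}{k}z_r^{\,n_r-k}(-1)^k\,\zeta_{r-1}(-n_1,\dots,-n_{r-2},-n_{r-1}-k;z_1,\dots,z_{r-1}). \] Symbolically, the added term is $(-1)^{n_r}(z_r-\mathcal{Z}_{r-1})^{n_r}$ with $\mathcal{Z}_{r-1}^k$ evaluated as $\zeta_{r-1}(-n_1,\dots,-n_{r-1}-k;z_1,\dots,z_{r-1})$.
   Context: Bernoulli numbers $B_m$ are defined by $\frac{t}{e^t-1}=\sum_{m\ge0}B_m\frac{t^m}{m!}$. Bernoulli polynomials are $B_m(z)=\sum_{j=0}^m\binom{m}{j}B_jz^{m-j}$. For positive integers $a_1,\dots,a_k$ and complex $z_1,\dots,z_k$, define recursively $V(a_1;z_1)=B_{a_1}(z_1)/a_1$ and, for $k\ge2$, \[ V(a_1,\dots,a_k;z_1,\dots,z_k)=\frac{1}{a_k}\sum_{j=0}^{a_k}\binom{a_k}{j}B_{a_k-j}(z_k)\,V(a_1,\dots,a_{k-2},a_{k-1}+j;z_1,\dots,z_{k-1}). \] This is the evaluated value of the symbolic product $\prod_{i=1}^k\mathcal{C}^{a_i}_{1,\dots,i}(z_1,\dots,z_i)$, where \[ \mathcal{C}^n_1(z_1)=\frac{(z_1+\mathcal{B}_1)^n}{n},\qquad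 \mathcal{C}^n_{1,\dots,k+1}=\frac{(\mathcal{C}_{1,\dots,k}+\mathcal{B}_{k+1}+z_{k+1})^n}{n}, \] and $(\mathcal{B}_j+z_j)^m$ is evaluated as $B_m(z_j)$. The shifted multiple zeta value at negative integers (the paper's symbolic form of Sadaoui's analytic continuation) is \[ \zeta_r(-n_1,\dots,-n_r;z_1,\dots,z_r)=(-1)^{n_1+\dots+n_r}\,V(n_1+1,\dots,n_r+1;z_1,\dots,z_r). \] -}

module Defs where

open import Level using (Level; _⊔_)
open import Data.Nat as ℕ using (ℕ; zero; suc; _∸_; _≤ᵇ_)
open import Data.Nat.Combinatorics using (_C_)
open import Data.Bool using (if_then_else_)
open import Data.Integer using (+_)
open import Data.Rational as ℚ using (ℚ; _/_)
open import Data.Rational.Properties using (+-*-rawRing)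
open import Data.Product using (_×_; _,_)
open import Data.List using (List; []; _∷_)
open import Data.Vec as Vec using (Vec; []; _∷_)
open import Algebra.Bundles using (CommutativeRing)
open import Algebra.Morphism.Structures using (IsRingHomomorphism)

-- Bernoulli numbers (convention t/(e^t-1), so B₁ = -1/2), via the
-- standard recurrence  B₀ = 1,  B_m = -1/(m+1) Σ_{j<m} C(m+1,j) B_j.

sumℚ : ℕ → (ℕ → ℚ) → ℚ
sumℚ zero    f = f 0
sumℚ (suc n) f = sumℚ n f ℚ.+ f (suc n)

-- bernTable m j = B_j for all j ≤ m
bernTable : ℕ → ℕ → ℚ
bernTable zero    _ = ℚ.1ℚ
bernTable (suc m) j =
  if j ≤ᵇ m then bernTable m j
  else ℚ.- ((+ 1 / suc (suc m)) ℚ.*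
            sumℚ m (λ i → (+ (suc (suc m) C i) / 1) ℚ.* bernTable m i))

bernoulli : ℕ → ℚ
bernoulli m = bernTable m m

-- 1/a for a ≥ 1 (value at 0 is irrelevant: only positive a occur)
inv : ℕ → ℚ
inv zero    = ℚ.0ℚ
inv (suc n) = + 1 / suc n

-- A ℚ-algebra: a commutative ring with a ring homomorphism from ℚ.
-- (ℂ is one; the stdlib has no complex numbers.)

record QAlgebra (c ℓ : Level) : Set (Level.suc (c ⊔ ℓ)) where
  field
    cring : CommutativeRing c ℓ
  open CommutativeRing cring public
  field
    ι     : ℚ → Carrier
    ι-hom : IsRingHomomorphism +-*-rawRing rawRing ι

module _ {c ℓ : Level} (A : QAlgebra c ℓ) where
  open QAlgebra A

  pow : Carrier → ℕ → Carrier
  pow x zero    = 1#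
  pow x (suc n) = x * pow x n

  sgn : ℕ → Carrier
  sgn zero    = 1#
  sgn (suc n) = - sgn n

  sumTo : ℕ → (ℕ → Carrier) → Carrier
  sumTo zero    f = f 0
  sumTo (suc n) f = sumTo n f + f (suc n)

  bernPoly : ℕ → Carrier → Carrier
  bernPoly m z = sumTo m (λ j → ι (+ (m C j) / 1) * ι (bernoulli j) * pow z (m ∸ j))

  -- Vrev a z ps = V(…, a; …, z) where ps lists the preceding pairs
  -- (a_i, z_i) in REVERSE order (nearest first).
  Vrev : ℕ → Carrier → List (ℕ × Carrier) → Carrier
  Vrev a z []                = ι (inv a) * bernPoly a z
  Vrev a z ((a' , z') ∷ ps)  =
    ι (inv a) * sumTo a (λ j → ι (+ (a C j) / 1) * bernPoly (a ∸ j) z * Vrev (a' ℕ.+ j) z' ps)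

  VrevVec : ∀ {k} → Vec (ℕ × Carrier) (suc k) → Carrier
  VrevVec ((a , z) ∷ ps) = Vrev a z (Vec.toList ps)

  V : ∀ {k} → Vec ℕ (suc k) → Vec Carrier (suc k) → Carrier
  V as zs = VrevVec (Vec.reverse (Vec.zip as zs))

  -- ζ_r(-n₁,…,-n_r; z₁,…,z_r) = (-1)^{n₁+…+n_r} V(n₁+1,…,n_r+1; z₁,…,z_r)
  zeta : ∀ {k} → Vec ℕ (suc k) → Vec Carrier (suc k) → Carrier
  zeta ns zs = sgn (Vec.sum ns) * V (Vec.map suc ns) zs

{-# OPTIONS --safe #-}
module Submission where

-- Shifting z by 1 changes the Bernoulli polynomial by B_k(z + 1) - B_k(z) = k z^(k-1). In the
-- outermost step of the recursion for V this adds
--   1/(n+1) Σ_j C(n+1,j) (n+1-j) z^(n-j) V(…, n'+1+j) = Σ_{j≤n} C(n,j) z^(n-j) V(…, n'+1+j),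
-- and the signs (-1)^(n₁+…) redistribute into those of the ζ_{r-1} values. The identity for
-- B_k is proved umbrally: B_k(z) = (𝔟 + z)^k with 𝔟^j ↦ B_j, the Bernoulli recurrence says
-- (𝔟 + 1)^j = 𝔟^j + [j = 1], and (𝔟 + (z + 1))^k = ((𝔟 + 1) + z)^k.

open import Defs
open import Level using (Level)
open import Function using (_∘_)
open import Data.Bool using (false)
open import Data.Bool.Properties using (T-≡)
open import Function.Bundles using (Equivalence)
open import Data.Nat as ℕ using (ℕ; zero; suc; _∸_; _≤_; _!; s≤s)
import Data.Nat.Properties as ℕₚ
open ℕₚ using (_!≢0; _!*_!≢0)
open import Data.Nat.Combinatorics
  using (_C_; k![n∸k]!∣n!; nCk≡nC[n∸k]; nC1≡n; nCn≡1; nCk+nC[k+1]≡[n+1]C[k+1])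
open import Data.Nat.Combinatorics.Specification using (nCk≡n!/k![n-k]!; k>n⇒nCk≡0)
open import Data.Nat.DivMod using (m/n*n≡m)
open import Data.Nat.Coprimality as Coprime using (1-coprimeTo)
open import Data.Integer as ℤ using (+_)
import Data.Integer.Properties as ℤₚ
open import Data.Rational as ℚ using (ℚ; _/_; mkℚ)
import Data.Rational.Properties as ℚₚ
open import Data.Product using (_×_; _,_)
open import Data.Sum using (inj₁; inj₂)
open import Data.List using (List; _∷_)
open import Data.Vec as Vec using (Vec; _∷ʳ_; []; _∷_)
import Data.Vec.Properties as Vecₚ
open import Algebra.Morphism.Structures using (IsRingHomomorphism)
import Algebra.Properties.Ring as RingProperties
import Algebra.Solver.Ring.NaturalCoefficients.Default as NaturalCoefficientsSolver
import Relation.Binary.Reasoning.Setoid as SetoidReasoning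
import Relation.Binary.PropositionalEquality as ≡
open ≡ using (_≡_)

nCk*[k!*[n∸k]!]≡n! : ∀ {n k} → k ≤ n → (n C k) ℕ.* (k ! ℕ.* (n ∸ k) !) ≡ n !
nCk*[k!*[n∸k]!]≡n! {n} {k} k≤n =
  ≡.trans (≡.cong (ℕ._* (k ! ℕ.* (n ∸ k) !)) (nCk≡n!/k![n-k]! k≤n))
          (m/n*n≡m {{k !* (n ∸ k) !≢0}} (k![n∸k]!∣n! k≤n))
  where instance _ = k !≢0
                 _ = (n ∸ k) !≢0

[1+n]Ck*[1+n∸k]≡[1+n]*nCk : ∀ {n k} → k ≤ n → (suc n C k) ℕ.* suc (n ∸ k) ≡ suc n ℕ.* (n C k)
[1+n]Ck*[1+n∸k]≡[1+n]*nCk {n} {k} k≤n =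
  ℕₚ.*-cancelʳ-≡ _ _ (k ! ℕ.* (n ∸ k) !) {{ℕₚ.m*n≢0 _ _ {{k !≢0}} {{(n ∸ k) !≢0}}}} (begin
    (suc n C k) ℕ.* suc (n ∸ k) ℕ.* (k ! ℕ.* (n ∸ k) !)
      ≡⟨ solve 4 (λ c s a b → c :* s :* (a :* b) := c :* (a :* (s :* b)))
                 ≡.refl (suc n C k) (suc (n ∸ k)) (k !) ((n ∸ k) !) ⟩
    (suc n C k) ℕ.* (k ! ℕ.* suc (n ∸ k) !)
      ≡⟨ ≡.cong (λ t → (suc n C k) ℕ.* (k ! ℕ.* t !)) (≡.sym (ℕₚ.+-∸-assoc 1 k≤n)) ⟩
    (suc n C k) ℕ.* (k ! ℕ.* (suc n ∸ k) !)
      ≡⟨ nCk*[k!*[n∸k]!]≡n! (ℕₚ.m≤n⇒m≤1+n k≤n) ⟩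
    suc n !
      ≡⟨ ≡.cong (suc n ℕ.*_) (nCk*[k!*[n∸k]!]≡n! k≤n) ⟨
    suc n ℕ.* ((n C k) ℕ.* (k ! ℕ.* (n ∸ k) !))
      ≡⟨ ℕₚ.*-assoc (suc n) (n C k) _ ⟨
    suc n ℕ.* (n C k) ℕ.* (k ! ℕ.* (n ∸ k) !) ∎)
  where
  open ≡.≡-Reasoning
  open import Data.Nat.Solver using (module +-*-Solver)
  open +-*-Solver

[2+m]C[1+m]≡2+m : ∀ m → suc (suc m) C suc m ≡ suc (suc m)
[2+m]C[1+m]≡2+m m = ≡.trans (nCk≡nC[n∸k] (ℕₚ.n≤1+n (suc m)))
  (≡.trans (≡.cong (suc (suc m) C_) (ℕₚ.m+n∸n≡m 1 (suc m))) (nC1≡n _))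

+n/1≡mkℚ : ∀ n → + n / 1 ≡ mkℚ (+ n) 0 (Coprime.sym (1-coprimeTo n))
+n/1≡mkℚ n = ℚₚ.normalize-coprime (Coprime.sym (1-coprimeTo n))

/1-homo-+ : ∀ m n → + (m ℕ.+ n) / 1 ≡ + m / 1 ℚ.+ + n / 1
/1-homo-+ m n rewrite +n/1≡mkℚ m | +n/1≡mkℚ n =
  ≡.cong (_/ 1) (≡.trans (ℤₚ.pos-+ m n)
    (≡.sym (≡.cong₂ ℤ._+_ (ℤₚ.*-identityʳ (+ m)) (ℤₚ.*-identityʳ (+ n)))))

/1-homo-* : ∀ m n → + (m ℕ.* n) / 1 ≡ (+ m / 1) ℚ.* (+ n / 1)
/1-homo-* m n rewrite +n/1≡mkℚ m | +n/1≡mkℚ n = ≡.cong (_/ 1) (ℤₚ.pos-* m n)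

inv*[1+n]/1≡1 : ∀ n → inv (suc n) ℚ.* (+ suc n / 1) ≡ ℚ.1ℚ
inv*[1+n]/1≡1 n = ≡.trans (≡.cong₂ ℚ._*_ inv≡1/ (+n/1≡mkℚ (suc n))) (ℚₚ.*-inverseˡ [1+n]/1)
  where
  [1+n]/1 : ℚ
  [1+n]/1 = mkℚ (+ suc n) 0 (Coprime.sym (1-coprimeTo (suc n)))
  inv≡1/ : inv (suc n) ≡ ℚ.1/ [1+n]/1
  inv≡1/ = ℚₚ.normalize-coprime (1-coprimeTo (suc n))

1+n≤ᵇn≡false : ∀ n → (suc n ℕ.≤ᵇ n) ≡ false
1+n≤ᵇn≡false zero    = ≡.refl
1+n≤ᵇn≡false (suc n) = 1+n≤ᵇn≡false n

bernTable-suc : ∀ {i m} → i ≤ m → bernTable (suc m) i ≡ bernTable m i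
bernTable-suc {i} {m} i≤m rewrite Equivalence.to T-≡ (ℕₚ.≤⇒≤ᵇ i≤m) = ≡.refl

bernTable-stable : ∀ {i m} → i ≤ m → bernTable m i ≡ bernoulli i
bernTable-stable {m = zero}  ℕ.z≤n = ≡.refl
bernTable-stable {m = suc m} i≤1+m with ℕₚ.m≤n⇒m<n∨m≡n i≤1+m
... | inj₁ (s≤s i≤m) = ≡.trans (bernTable-suc i≤m) (bernTable-stable i≤m)
... | inj₂ ≡.refl    = ≡.refl

bernoulli-suc : ∀ m → bernoulli (suc m)
  ≡ ℚ.- ((+ 1 / suc (suc m)) ℚ.* sumℚ m (λ i → (+ (suc (suc m) C i) / 1) ℚ.* bernTable m i))
bernoulli-suc m rewrite 1+n≤ᵇn≡false m = ≡.refl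

zip-∷ʳ : ∀ {a b} {X : Set a} {Y : Set b} {k} (xs : Vec X k) (ys : Vec Y k) x y →
         Vec.zip (xs ∷ʳ x) (ys ∷ʳ y) ≡ Vec.zip xs ys ∷ʳ (x , y)
zip-∷ʳ []       []       x y = ≡.refl
zip-∷ʳ (x′ ∷ xs) (y′ ∷ ys) x y = ≡.cong ((x′ , y′) ∷_) (zip-∷ʳ xs ys x y)

reverse-∷ʳ : ∀ {a} {X : Set a} {k} (xs : Vec X k) x → Vec.reverse (xs ∷ʳ x) ≡ x ∷ Vec.reverse xs
reverse-∷ʳ xs x = Vecₚ.foldl-∷ʳ (Vec _) (λ rev y → y ∷ rev) [] x xs

sum-∷ʳ : ∀ {k} (xs : Vec ℕ k) x → Vec.sum (xs ∷ʳ x) ≡ Vec.sum xs ℕ.+ x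
sum-∷ʳ []       x = ℕₚ.+-identityʳ x
sum-∷ʳ (y ∷ xs) x = ≡.trans (≡.cong (y ℕ.+_) (sum-∷ʳ xs x)) (≡.sym (ℕₚ.+-assoc y _ x))

preceding : ∀ {a} {X : Set a} {k} → Vec ℕ k → Vec X k → List (ℕ × X)
preceding ns zs = Vec.toList (Vec.reverse (Vec.zip (Vec.map suc ns) zs))

preceding-∷ʳ : ∀ {a} {X : Set a} {k} (ns : Vec ℕ k) (zs : Vec X k) n z →
               preceding (ns ∷ʳ n) (zs ∷ʳ z) ≡ (suc n , z) ∷ preceding ns zs
preceding-∷ʳ ns zs n z
  rewrite Vecₚ.map-∷ʳ suc n ns | zip-∷ʳ (Vec.map suc ns) zs (suc n) z
        | reverse-∷ʳ (Vec.zip (Vec.map suc ns) zs) (suc n , z) = ≡.refl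

module _ {c ℓ : Level} (A : QAlgebra c ℓ) where
  open QAlgebra A
  open SetoidReasoning setoid
  open NaturalCoefficientsSolver commutativeSemiring using (solve; _:=_; _:+_; _:*_; con)
  open IsRingHomomorphism ι-hom using (+-homo; *-homo; 1#-homo; 0#-homo; -‿homo)
  open RingProperties ring using (-‿distribˡ-*; -‿distribʳ-*; -‿involutive)

  zeta-∷ʳ : ∀ {k} (ns : Vec ℕ k) (zs : Vec Carrier k) n z →
            zeta A (ns ∷ʳ n) (zs ∷ʳ z) ≡ sgn A (Vec.sum ns ℕ.+ n) * Vrev A (suc n) z (preceding ns zs)
  zeta-∷ʳ ns zs n z
    rewrite sum-∷ʳ ns n | Vecₚ.map-∷ʳ suc n ns | zip-∷ʳ (Vec.map suc ns) zs (suc n) z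
          | reverse-∷ʳ (Vec.zip (Vec.map suc ns) zs) (suc n , z) = ≡.refl

  zeta-∷ʳ-∷ʳ : ∀ {k} (ns : Vec ℕ k) (zs : Vec Carrier k) n₁ n z₁ z →
    zeta A (ns ∷ʳ n₁ ∷ʳ n) (zs ∷ʳ z₁ ∷ʳ z)
      ≡ sgn A (Vec.sum ns ℕ.+ n₁ ℕ.+ n) * Vrev A (suc n) z ((suc n₁ , z₁) ∷ preceding ns zs)
  zeta-∷ʳ-∷ʳ ns zs n₁ n z₁ z
    rewrite zeta-∷ʳ (ns ∷ʳ n₁) (zs ∷ʳ z₁) n z | sum-∷ʳ ns n₁ | preceding-∷ʳ ns zs n₁ z₁ = ≡.refl

  fromℕ : ℕ → Carrier
  fromℕ n = ι (+ n / 1)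

  fromℕ-+ : ∀ m n → fromℕ (m ℕ.+ n) ≈ fromℕ m + fromℕ n
  fromℕ-+ m n = trans (reflexive (≡.cong ι (/1-homo-+ m n))) (+-homo _ _)

  fromℕ-* : ∀ m n → fromℕ (m ℕ.* n) ≈ fromℕ m * fromℕ n
  fromℕ-* m n = trans (reflexive (≡.cong ι (/1-homo-* m n))) (*-homo _ _)

  inv*fromℕ : ∀ n → ι (inv (suc n)) * fromℕ (suc n) ≈ 1#
  inv*fromℕ n = trans (sym (*-homo _ _)) (trans (reflexive (≡.cong ι (inv*[1+n]/1≡1 n))) 1#-homo)

  sgn-+ : ∀ m n → sgn A (m ℕ.+ n) ≈ sgn A m * sgn A n
  sgn-+ zero    n = sym (*-identityˡ _)
  sgn-+ (suc m) n = trans (-‿cong (sgn-+ m n)) (-‿distribˡ-* _ _)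

  sgn*sgn : ∀ n → sgn A n * sgn A n ≈ 1#
  sgn*sgn zero    = *-identityˡ _
  sgn*sgn (suc n) = begin
    - sgn A n * - sgn A n   ≈⟨ -‿distribˡ-* _ _ ⟨
    - (sgn A n * - sgn A n) ≈⟨ -‿cong (-‿distribʳ-* _ _) ⟨
    - - (sgn A n * sgn A n) ≈⟨ -‿involutive _ ⟩
    sgn A n * sgn A n       ≈⟨ sgn*sgn n ⟩
    1#                      ∎

  sgn-+-exchange : ∀ t m n x y →
    sgn A (t ℕ.+ m) * (x * y) ≈ sgn A m * (x * sgn A n * (sgn A (t ℕ.+ n) * y))
  sgn-+-exchange t m n x y = sym (begin
    sgn A m * (x * sgn A n * (sgn A (t ℕ.+ n) * y))
      ≈⟨ *-cong refl (*-cong refl (*-cong (sgn-+ t n) refl)) ⟩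
    sgn A m * (x * sgn A n * (sgn A t * sgn A n * y))
      ≈⟨ solve 5 (λ s u v x y → u :* (x :* v :* (s :* v :* y)) := (v :* v) :* (s :* u :* (x :* y)))
               refl (sgn A t) (sgn A m) (sgn A n) x y ⟩
    (sgn A n * sgn A n) * (sgn A t * sgn A m * (x * y))
      ≈⟨ trans (*-cong (sgn*sgn n) refl) (*-identityˡ _) ⟩
    sgn A t * sgn A m * (x * y)
      ≈⟨ *-cong (sgn-+ t m) refl ⟨
    sgn A (t ℕ.+ m) * (x * y)
      ∎)

  sumTo-cong-≤ : ∀ n {f g} → (∀ i → i ≤ n → f i ≈ g i) → sumTo A n f ≈ sumTo A n g
  sumTo-cong-≤ zero    f≈g = f≈g 0 ℕ.z≤n
  sumTo-cong-≤ (suc n) f≈g =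
    +-cong (sumTo-cong-≤ n (λ i i≤n → f≈g i (ℕₚ.m≤n⇒m≤1+n i≤n))) (f≈g (suc n) ℕₚ.≤-refl)

  sumTo-cong : ∀ n {f g} → (∀ i → f i ≈ g i) → sumTo A n f ≈ sumTo A n g
  sumTo-cong n f≈g = sumTo-cong-≤ n (λ i _ → f≈g i)

  sumTo-+ : ∀ n f g → sumTo A n (λ i → f i + g i) ≈ sumTo A n f + sumTo A n g
  sumTo-+ zero    f g = refl
  sumTo-+ (suc n) f g = trans (+-cong (sumTo-+ n f g) refl)
    (solve 4 (λ a b c d → (a :+ b) :+ (c :+ d) := (a :+ c) :+ (b :+ d))
           refl (sumTo A n f) (sumTo A n g) (f (suc n)) (g (suc n)))

  sumTo-zeros : ∀ n → sumTo A n (λ _ → 0#) ≈ 0#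
  sumTo-zeros zero    = refl
  sumTo-zeros (suc n) = trans (+-identityʳ _) (sumTo-zeros n)

  *-distribˡ-sumTo : ∀ n x f → x * sumTo A n f ≈ sumTo A n (λ i → x * f i)
  *-distribˡ-sumTo zero    x f = refl
  *-distribˡ-sumTo (suc n) x f = trans (distribˡ x _ _) (+-cong (*-distribˡ-sumTo n x f) refl)

  sumTo-suc : ∀ n f → sumTo A (suc n) f ≈ f 0 + sumTo A n (f ∘ suc)
  sumTo-suc zero    f = refl
  sumTo-suc (suc n) f = trans (+-cong (sumTo-suc n f) refl) (+-assoc _ _ _)

  ι-sumℚ : ∀ n f → ι (sumℚ n f) ≈ sumTo A n (ι ∘ f)
  ι-sumℚ zero    f = refl
  ι-sumℚ (suc n) f = trans (+-homo _ _) (+-cong (ι-sumℚ n f) refl)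

  pow-1# : ∀ n → pow A 1# n ≈ 1#
  pow-1# zero    = refl
  pow-1# (suc n) = trans (*-identityˡ _) (pow-1# n)

  -- (𝔟 + z)^m with 𝔟^j read as b j, so that bernPoly A m is umbral m B below.
  umbral : ℕ → (ℕ → Carrier) → Carrier → Carrier
  umbral m b z = sumTo A m (λ j → fromℕ (m C j) * b j * pow A z (m ∸ j))

  umbral-cong : ∀ m {b b′} z → (∀ j → b j ≈ b′ j) → umbral m b z ≈ umbral m b′ z
  umbral-cong m z b≈b′ = sumTo-cong m (λ j → *-cong (*-cong refl (b≈b′ j)) refl)

  umbral-+ : ∀ m b b′ z → umbral m (λ j → b j + b′ j) z ≈ umbral m b z + umbral m b′ z
  umbral-+ m b b′ z = trans (sumTo-cong m split) (sumTo-+ m _ _)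
    where
    split : ∀ j → fromℕ (m C j) * (b j + b′ j) * pow A z (m ∸ j)
                  ≈ fromℕ (m C j) * b j * pow A z (m ∸ j) + fromℕ (m C j) * b′ j * pow A z (m ∸ j)
    split j = solve 4 (λ c x y p → c :* (x :+ y) :* p := c :* x :* p :+ c :* y :* p)
                        refl (fromℕ (m C j)) (b j) (b′ j) (pow A z (m ∸ j))

  umbral-0 : ∀ b z → umbral 0 b z ≈ b 0
  umbral-0 b z = trans (*-identityʳ _) (trans (*-cong 1#-homo refl) (*-identityˡ _))

  umbral-zeros : ∀ m z → umbral m (λ _ → 0#) z ≈ 0#
  umbral-zeros m z = trans (sumTo-cong m (λ j → trans (*-cong (zeroʳ _) refl) (zeroˡ _))) (sumTo-zeros m)

  umbral-1# : ∀ m b → umbral m b 1# ≈ sumTo A m (λ j → fromℕ (m C j) * b j)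
  umbral-1# m b = sumTo-cong m (λ j → trans (*-cong refl (pow-1# (m ∸ j))) (*-identityʳ _))

  umbral-suc : ∀ m b z → umbral (suc m) b z ≈ z * umbral m b z + umbral m (b ∘ suc) z
  umbral-suc m b z = begin
    umbral (suc m) b z
      ≈⟨ sumTo-suc m _ ⟩
    h 0 + sumTo A m (λ j → fromℕ (suc m C suc j) * b (suc j) * pow A z (m ∸ j))
      ≈⟨ +-cong refl (trans (sumTo-cong m pascal) (sumTo-+ m _ _)) ⟩
    h 0 + (umbral m (b ∘ suc) z + sumTo A m (h ∘ suc))
      ≈⟨ solve 3 (λ x y w → x :+ (y :+ w) := (x :+ w) :+ y)
               refl (h 0) (umbral m (b ∘ suc) z) (sumTo A m (h ∘ suc)) ⟩
    (h 0 + sumTo A m (h ∘ suc)) + umbral m (b ∘ suc) z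
      ≈⟨ +-cong (sym (sumTo-suc m h)) refl ⟩
    sumTo A m h + h (suc m) + umbral m (b ∘ suc) z
      ≈⟨ +-cong (+-cong (sumTo-cong-≤ m h≈z*term) h[1+m]≈0) refl ⟩
    sumTo A m (λ j → z * term j) + 0# + umbral m (b ∘ suc) z
      ≈⟨ +-cong (trans (+-identityʳ _) (sym (*-distribˡ-sumTo m z term))) refl ⟩
    z * umbral m b z + umbral m (b ∘ suc) z
      ∎
    where
    term h : ℕ → Carrier
    term j = fromℕ (m C j) * b j * pow A z (m ∸ j)
    h j = fromℕ (m C j) * b j * pow A z (suc m ∸ j)
    pascal : ∀ j → fromℕ (suc m C suc j) * b (suc j) * pow A z (m ∸ j)
                 ≈ fromℕ (m C j) * b (suc j) * pow A z (m ∸ j) + h (suc j)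
    pascal j = trans
      (*-cong (*-cong (trans (reflexive (≡.cong fromℕ (≡.sym (nCk+nC[k+1]≡[n+1]C[k+1] m j))))
                             (fromℕ-+ (m C j) (m C suc j))) refl) refl)
      (solve 4 (λ x y v p → (x :+ y) :* v :* p := x :* v :* p :+ y :* v :* p)
             refl (fromℕ (m C j)) (fromℕ (m C suc j)) (b (suc j)) (pow A z (m ∸ j)))
    h≈z*term : ∀ j → j ≤ m → h j ≈ z * term j
    h≈z*term j j≤m = trans (*-cong refl (reflexive (≡.cong (pow A z) (ℕₚ.+-∸-assoc 1 j≤m))))
      (solve 4 (λ c v y p → c :* v :* (y :* p) := y :* (c :* v :* p))
             refl (fromℕ (m C j)) (b j) z (pow A z (m ∸ j)))
    h[1+m]≈0 : h (suc m) ≈ 0#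
    h[1+m]≈0 = trans (*-cong (*-cong (trans (reflexive (≡.cong fromℕ (k>n⇒nCk≡0 (ℕₚ.n<1+n m)))) 0#-homo)
                                     refl) refl)
                     (trans (*-cong (zeroˡ _) refl) (zeroˡ _))

  umbral-shift : ∀ m b z → umbral m b (z + 1#) ≈ umbral m (λ j → umbral j b 1#) z
  umbral-shift zero    b z = trans (umbral-0 b (z + 1#)) (sym (trans (umbral-0 (λ j → umbral j b 1#) z) (umbral-0 b 1#)))
  umbral-shift (suc m) b z = begin
    umbral (suc m) b (z + 1#)
      ≈⟨ umbral-suc m b (z + 1#) ⟩
    (z + 1#) * umbral m b (z + 1#) + umbral m (b ∘ suc) (z + 1#)
      ≈⟨ +-cong (*-cong refl (umbral-shift m b z)) (umbral-shift m (b ∘ suc) z) ⟩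
    (z + 1#) * umbral m b+1 z + umbral m b′+1 z
      ≈⟨ solve 3 (λ z x y → (z :+ con 1) :* x :+ y := z :* x :+ (x :+ y))
               refl z (umbral m b+1 z) (umbral m b′+1 z) ⟩
    z * umbral m b+1 z + (umbral m b+1 z + umbral m b′+1 z)
      ≈⟨ +-cong refl (trans (sym (umbral-+ m b+1 b′+1 z)) (umbral-cong m z b+1-suc)) ⟩
    z * umbral m b+1 z + umbral m (b+1 ∘ suc) z
      ≈⟨ umbral-suc m b+1 z ⟨
    umbral (suc m) b+1 z
      ∎
    where
    b+1 b′+1 : ℕ → Carrier
    b+1 j = umbral j b 1#
    b′+1 j = umbral j (b ∘ suc) 1#
    b+1-suc : ∀ j → b+1 j + b′+1 j ≈ b+1 (suc j)
    b+1-suc j = sym (trans (umbral-suc j b 1#) (+-cong (*-identityˡ _) refl))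

  δ₀ δ₁ : ℕ → Carrier
  δ₀ zero    = 1#
  δ₀ (suc _) = 0#
  δ₁ zero    = 0#
  δ₁ (suc j) = δ₀ j

  derivPow : ℕ → Carrier → Carrier
  derivPow zero    z = 0#
  derivPow (suc k) z = fromℕ (suc k) * pow A z k

  umbral-δ₀ : ∀ m z → umbral m δ₀ z ≈ pow A z m
  umbral-δ₀ zero    z = umbral-0 δ₀ z
  umbral-δ₀ (suc m) z = begin
    umbral (suc m) δ₀ z                       ≈⟨ umbral-suc m δ₀ z ⟩
    z * umbral m δ₀ z + umbral m (λ _ → 0#) z ≈⟨ +-cong (*-cong refl (umbral-δ₀ m z)) (umbral-zeros m z) ⟩
    z * pow A z m + 0#                        ≈⟨ +-identityʳ _ ⟩
    pow A z (suc m)                           ∎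

  umbral-δ₁ : ∀ m z → umbral m δ₁ z ≈ derivPow m z
  umbral-δ₁ zero    z = umbral-0 δ₁ z
  umbral-δ₁ (suc m) z = begin
    umbral (suc m) δ₁ z               ≈⟨ umbral-suc m δ₁ z ⟩
    z * umbral m δ₁ z + umbral m δ₀ z ≈⟨ +-cong (*-cong refl (umbral-δ₁ m z)) (umbral-δ₀ m z) ⟩
    z * derivPow m z + pow A z m      ≈⟨ derivPow-suc m ⟩
    derivPow (suc m) z                ∎
    where
    derivPow-suc : ∀ m → z * derivPow m z + pow A z m ≈ derivPow (suc m) z
    derivPow-suc zero    = trans (+-cong (zeroʳ z) refl)
                                 (trans (+-identityˡ _) (sym (trans (*-identityʳ _) 1#-homo)))
    derivPow-suc (suc k) = begin
      z * (fromℕ (suc k) * pow A z k) + z * pow A z k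
        ≈⟨ solve 3 (λ z n p → z :* (n :* p) :+ z :* p := (con 1 :+ n) :* (z :* p))
                 refl z (fromℕ (suc k)) (pow A z k) ⟩
      (1# + fromℕ (suc k)) * pow A z (suc k)
        ≈⟨ *-cong (trans (fromℕ-+ 1 (suc k)) (+-cong 1#-homo refl)) refl ⟨
      fromℕ (suc (suc k)) * pow A z (suc k)
        ∎

  B : ℕ → Carrier
  B j = ι (bernoulli j)

  bernoulli-recurrence : ∀ m → sumTo A (suc m) (λ i → fromℕ (suc (suc m) C i) * B i) ≈ 0#
  bernoulli-recurrence m = begin
    sumTo A m g + g (suc m)
      ≈⟨ +-cong (trans (sumTo-cong-≤ m g≈ι∘h) (sym (ι-sumℚ m h))) g[1+m]≈-X ⟩
    ι X + - ι X
      ≈⟨ -‿inverseʳ _ ⟩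
    0# ∎
    where
    h : ℕ → ℚ
    h i = (+ (suc (suc m) C i) / 1) ℚ.* bernTable m i
    X : ℚ
    X = sumℚ m h
    g : ℕ → Carrier
    g i = fromℕ (suc (suc m) C i) * B i
    g≈ι∘h : ∀ i → i ≤ m → g i ≈ ι (h i)
    g≈ι∘h i i≤m = trans (*-cong refl (reflexive (≡.cong ι (≡.sym (bernTable-stable i≤m)))))
                        (sym (*-homo _ _))
    N I : Carrier
    N = fromℕ (suc (suc m))
    I = ι (inv (suc (suc m)))
    g[1+m]≈-X : g (suc m) ≈ - ι X
    g[1+m]≈-X = begin
      fromℕ (suc (suc m) C suc m) * B (suc m)
        ≈⟨ *-cong (reflexive (≡.cong fromℕ ([2+m]C[1+m]≡2+m m))) (reflexive (≡.cong ι (bernoulli-suc m))) ⟩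
      N * ι (ℚ.- (inv (suc (suc m)) ℚ.* X))
        ≈⟨ *-cong refl (trans (-‿homo _) (-‿cong (*-homo _ _))) ⟩
      N * - (I * ι X)
        ≈⟨ -‿distribʳ-* _ _ ⟨
      - (N * (I * ι X))
        ≈⟨ -‿cong (solve 3 (λ n i x → n :* (i :* x) := (i :* n) :* x) refl N I (ι X)) ⟩
      - ((I * N) * ι X)
        ≈⟨ -‿cong (trans (*-cong (inv*fromℕ (suc m)) refl) (*-identityˡ _)) ⟩
      - ι X ∎

  umbral-B-1# : ∀ j → umbral j B 1# ≈ B j + δ₁ j
  umbral-B-1# zero = trans (umbral-0 B 1#) (sym (+-identityʳ _))
  umbral-B-1# (suc zero) = begin
    fromℕ 1 * B 0 * (1# * 1#) + fromℕ 1 * B 1 * 1#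
      ≈⟨ +-cong (*-cong (*-cong 1#-homo 1#-homo) refl) (*-cong (*-cong 1#-homo refl) refl) ⟩
    1# * 1# * (1# * 1#) + 1# * B 1 * 1#
      ≈⟨ solve 1 (λ b → con 1 :* con 1 :* (con 1 :* con 1) :+ con 1 :* b :* con 1 := b :+ con 1) refl (B 1) ⟩
    B 1 + 1# ∎
  umbral-B-1# (suc (suc m)) = begin
    umbral j B 1#
      ≈⟨ umbral-1# j B ⟩
    sumTo A (suc m) (λ i → fromℕ (j C i) * B i) + fromℕ (j C j) * B j
      ≈⟨ +-cong (bernoulli-recurrence m) (*-cong (trans (reflexive (≡.cong fromℕ (nCn≡1 j))) 1#-homo) refl) ⟩
    0# + 1# * B j
      ≈⟨ trans (+-comm _ _) (+-cong (*-identityˡ _) refl) ⟩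
    B j + 0# ∎
    where j = suc (suc m)

  bernPoly-+1 : ∀ k z → bernPoly A k (z + 1#) ≈ bernPoly A k z + derivPow k z
  bernPoly-+1 k z = begin
    umbral k B (z + 1#)              ≈⟨ umbral-shift k B z ⟩
    umbral k (λ j → umbral j B 1#) z ≈⟨ umbral-cong k z umbral-B-1# ⟩
    umbral k (λ j → B j + δ₁ j) z    ≈⟨ umbral-+ k B δ₁ z ⟩
    umbral k B z + umbral k δ₁ z     ≈⟨ +-cong refl (umbral-δ₁ k z) ⟩
    umbral k B z + derivPow k z      ∎

  inv*sumTo-derivPow : ∀ n z (w : ℕ → Carrier) →
    ι (inv (suc n)) * sumTo A (suc n) (λ j → fromℕ (suc n C j) * derivPow (suc n ∸ j) z * w j)
      ≈ sumTo A n (λ j → fromℕ (n C j) * pow A z (n ∸ j) * w j)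
  inv*sumTo-derivPow n z w = begin
    I * (sumTo A n G + G (suc n))  ≈⟨ *-cong refl (trans (+-cong refl G[1+n]≈0) (+-identityʳ _)) ⟩
    I * sumTo A n G                ≈⟨ *-distribˡ-sumTo n I G ⟩
    sumTo A n (λ j → I * G j)      ≈⟨ sumTo-cong-≤ n I*G≈H ⟩
    sumTo A n H                    ∎
    where
    I : Carrier
    I = ι (inv (suc n))
    G H : ℕ → Carrier
    G j = fromℕ (suc n C j) * derivPow (suc n ∸ j) z * w j
    H j = fromℕ (n C j) * pow A z (n ∸ j) * w j
    G[1+n]≈0 : G (suc n) ≈ 0#
    G[1+n]≈0 = trans (*-cong (*-cong refl (reflexive (≡.cong (λ k → derivPow k z) (ℕₚ.n∸n≡0 n)))) refl)
                     (trans (*-cong (zeroʳ _) refl) (zeroˡ _))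
    I*G≈H : ∀ j → j ≤ n → I * G j ≈ H j
    I*G≈H j j≤n = begin
      I * (fromℕ (suc n C j) * derivPow (suc n ∸ j) z * w j)
        ≈⟨ *-cong refl (*-cong (*-cong refl (reflexive (≡.cong (λ k → derivPow k z) (ℕₚ.+-∸-assoc 1 j≤n)))) refl) ⟩
      I * (fromℕ (suc n C j) * (fromℕ (suc (n ∸ j)) * pow A z (n ∸ j)) * w j)
        ≈⟨ solve 5 (λ i c d p v → i :* (c :* (d :* p) :* v) := i :* (c :* d) :* p :* v)
                 refl I (fromℕ (suc n C j)) (fromℕ (suc (n ∸ j))) (pow A z (n ∸ j)) (w j) ⟩
      I * (fromℕ (suc n C j) * fromℕ (suc (n ∸ j))) * pow A z (n ∸ j) * w j
        ≈⟨ *-cong (*-cong (*-cong refl absorb) refl) refl ⟩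
      I * (fromℕ (suc n) * fromℕ (n C j)) * pow A z (n ∸ j) * w j
        ≈⟨ *-cong (*-cong (trans (sym (*-assoc _ _ _)) (trans (*-cong (inv*fromℕ n) refl) (*-identityˡ _))) refl) refl ⟩
      H j ∎
      where
      absorb : fromℕ (suc n C j) * fromℕ (suc (n ∸ j)) ≈ fromℕ (suc n) * fromℕ (n C j)
      absorb = trans (sym (fromℕ-* (suc n C j) (suc (n ∸ j))))
        (trans (reflexive (≡.cong fromℕ ([1+n]Ck*[1+n∸k]≡[1+n]*nCk j≤n))) (fromℕ-* (suc n) (n C j)))

  Vrev-+1 : ∀ n a z′ ps z → Vrev A (suc n) (z + 1#) ((a , z′) ∷ ps)
    ≈ Vrev A (suc n) z ((a , z′) ∷ ps)
      + sumTo A n (λ j → fromℕ (n C j) * pow A z (n ∸ j) * Vrev A (a ℕ.+ j) z′ ps)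
  Vrev-+1 n a z′ ps z = begin
    I * sumTo A (suc n) (F (z + 1#))
      ≈⟨ *-cong refl (trans (sumTo-cong (suc n) F[z+1]≈F[z]+G) (sumTo-+ (suc n) (F z) G)) ⟩
    I * (sumTo A (suc n) (F z) + sumTo A (suc n) G)
      ≈⟨ distribˡ _ _ _ ⟩
    I * sumTo A (suc n) (F z) + I * sumTo A (suc n) G
      ≈⟨ +-cong refl (inv*sumTo-derivPow n z W) ⟩
    I * sumTo A (suc n) (F z) + sumTo A n (λ j → fromℕ (n C j) * pow A z (n ∸ j) * W j)
      ∎
    where
    I : Carrier
    I = ι (inv (suc n))
    W G : ℕ → Carrier
    W j = Vrev A (a ℕ.+ j) z′ ps
    G j = fromℕ (suc n C j) * derivPow (suc n ∸ j) z * W j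
    F : Carrier → ℕ → Carrier
    F v j = fromℕ (suc n C j) * bernPoly A (suc n ∸ j) v * W j
    F[z+1]≈F[z]+G : ∀ j → F (z + 1#) j ≈ F z j + G j
    F[z+1]≈F[z]+G j = trans (*-cong (*-cong refl (bernPoly-+1 (suc n ∸ j) z)) refl)
      (solve 4 (λ c x y v → c :* (x :+ y) :* v := c :* x :* v :+ c :* y :* v)
             refl (fromℕ (suc n C j)) (bernPoly A (suc n ∸ j) z) (derivPow (suc n ∸ j) z) (W j))

theorem4 : ∀ {c ℓ : Level} (A : QAlgebra c ℓ) → let open QAlgebra A in
    (m : ℕ) (ns : Vec ℕ m) (zs : Vec Carrier m) (n₁ n : ℕ) (z₁ z : Carrier) →
    zeta A (ns ∷ʳ n₁ ∷ʳ n) (zs ∷ʳ z₁ ∷ʳ (z + 1#))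
      ≈ zeta A (ns ∷ʳ n₁ ∷ʳ n) (zs ∷ʳ z₁ ∷ʳ z)
        + sgn A n * sumTo A n (λ k →
            ι (+ (n C k) / 1) * pow A z (n ∸ k) * sgn A k
              * zeta A (ns ∷ʳ (n₁ ℕ.+ k)) (zs ∷ʳ z₁))
theorem4 A m ns zs n₁ n z₁ z = begin
  zeta A (ns ∷ʳ n₁ ∷ʳ n) (zs ∷ʳ z₁ ∷ʳ (z + 1#))
    ≡⟨ zeta-∷ʳ-∷ʳ A ns zs n₁ n z₁ (z + 1#) ⟩
  s * Vrev A (suc n) (z + 1#) ((suc n₁ , z₁) ∷ ps)
    ≈⟨ trans (*-cong refl (Vrev-+1 A n (suc n₁) z₁ ps z)) (distribˡ _ _ _) ⟩
  s * Vrev A (suc n) z ((suc n₁ , z₁) ∷ ps) + s * sumTo A n H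
    ≈⟨ +-cong (reflexive (≡.sym (zeta-∷ʳ-∷ʳ A ns zs n₁ n z₁ z))) (*-distribˡ-sumTo A n s H) ⟩
  zeta A (ns ∷ʳ n₁ ∷ʳ n) (zs ∷ʳ z₁ ∷ʳ z) + sumTo A n (λ k → s * H k)
    ≈⟨ +-cong refl (trans (sumTo-cong A n s*H≈) (sym (*-distribˡ-sumTo A n (sgn A n) _))) ⟩
  zeta A (ns ∷ʳ n₁ ∷ʳ n) (zs ∷ʳ z₁ ∷ʳ z)
    + sgn A n * sumTo A n (λ k → fromℕ A (n C k) * pow A z (n ∸ k) * sgn A k
                                   * zeta A (ns ∷ʳ (n₁ ℕ.+ k)) (zs ∷ʳ z₁))
    ∎
  where
  open QAlgebra A
  open SetoidReasoning setoid
  T : ℕ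
  T = Vec.sum ns ℕ.+ n₁
  s : Carrier
  s = sgn A (T ℕ.+ n)
  ps : List (ℕ × Carrier)
  ps = preceding ns zs
  W H : ℕ → Carrier
  W k = Vrev A (suc (n₁ ℕ.+ k)) z₁ ps
  H k = fromℕ A (n C k) * pow A z (n ∸ k) * W k
  zeta≡ : ∀ k → zeta A (ns ∷ʳ (n₁ ℕ.+ k)) (zs ∷ʳ z₁) ≡ sgn A (T ℕ.+ k) * W k
  zeta≡ k = ≡.trans (zeta-∷ʳ A ns zs (n₁ ℕ.+ k) z₁)
                    (≡.cong (λ t → sgn A t * W k) (≡.sym (ℕₚ.+-assoc (Vec.sum ns) n₁ k)))
  s*H≈ : ∀ k → s * H k ≈ sgn A n * (fromℕ A (n C k) * pow A z (n ∸ k) * sgn A k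
                                      * zeta A (ns ∷ʳ (n₁ ℕ.+ k)) (zs ∷ʳ z₁))
  s*H≈ k = trans (sgn-+-exchange A T n k _ (W k)) (*-cong refl (*-cong refl (reflexive (≡.sym (zeta≡ k)))))
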